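{- Let $\mathsf{P}$ be a finite graded poset of rank $r$, let $A$ be an antichain of $\mathsf{P}$ and $p\in\mathsf{P}$. (1) If $\mathrm{rk}(p)=0$, then $p\in\mathrm{rvac}_{\mathcal{A}}(A)$ if and only if $p\in\boldsymbol{\tau}_0(A)$, i.e., if and only if $A$ contains no element $q\ge p$. (2) If $\mathrm{rk}(p)\ge1$, then $p\in\mathrm{rvac}_{\mathcal{A}}(A)$ if and only if $p\in\mathrm{row}_{\mathcal{A}}^{ -1}(\mathrm{rvac}_{\mathcal{A}}(\overline{A}))$, where $\overline{A}=A\cap\mathsf{P}_{\ge1}$ and $\mathrm{row}_{\mathcal{A}}$, $\mathrm{rvac}_{\mathcal{A}}$ here are the operators for the graded poset $\mathsf{P}_{\ge1}$.
   Context: $\mathsf{P}$ is graded of rank $r$ (rank function $\mathrm{rk}$, minimal elements rank $0$, maximal rank $r$, rank increases by one along covers); $\mathsf{P}_i$ is rank $i$, and $\mathsf{P}_{\ge1}=\bigcup_{j\ge1}\mathsf{P}_j$ is a graded poset of rank $r-1$ with rank function $\mathrm{rk}-1$. Antichain toggle: $\tau_p(A)=A\cup\{p\}$ if $p\notin A$ and $A\cup\{p\}$ is an antichain, $A\setminus\{p\}$ if $p\in A$, else $A$. $\boldsymbol{\tau}_i=\prod_{p\in\mathsf{P}_i}\tau_p$. Products are compositions, rightmost applied first. $\mathrm{row}_{\mathcal{A}}=\boldsymbol{\tau}_r\cdots\boldsymbol{\tau}_1\boldsymbol{\tau}_0$ (equivalently, $\mathrm{row}_{\mathcal{A}}(A)$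 is the set of minimal elements of $\{x: x\not\le y\ \forall y\in A\}$), and $\mathrm{rvac}_{\mathcal{A}}=(\boldsymbol{\tau}_r)(\boldsymbol{\tau}_r\boldsymbol{\tau}_{r-1})\cdots(\boldsymbol{\tau}_r\cdots\boldsymbol{\tau}_1)(\boldsymbol{\tau}_r\cdots\boldsymbol{\tau}_1\boldsymbol{\tau}_0)$; the same definitions apply to $\mathsf{P}_{\ge1}$ with its own ranks. -}

module Defs where

open import Data.Nat using (ℕ; zero; suc; _≤_; _∸_; _+_; _≤?_)
open import Data.Nat.Properties using (≤-irrelevant)
open import Data.Bool using (Bool; true; false; if_then_else_; _∧_; _∨_; not)
open import Data.List using (List; []; _∷_; foldr; foldl; filter; map; upTo; reverse; mapMaybe)
open import Data.List.Membership.Propositional using (_∈_)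
open import Data.List.Relation.Unary.Unique.Propositional using (Unique)
open import Data.Sum using (_⊎_)
open import Data.Maybe using (Maybe; just; nothing)
open import Data.Product using (Σ; _,_; proj₁; _×_; ∃)
open import Relation.Binary.PropositionalEquality using (_≡_; _≢_; refl; cong)
open import Relation.Binary.Definitions using (Decidable; DecidableEquality)
open import Relation.Binary.Structures using (IsPartialOrder)
open import Relation.Nullary using (¬_; Dec; yes; no; does)

record RankedFinPoset : Set₁ where
  field
    Carrier : Set
    _≟_     : DecidableEquality Carrier
    elems   : List Carrier
    _≼_     : Carrier → Carrier → Set
    _≼?_    : Decidable _≼_
    rank    : ℕ
    rk      : Carrier → ℕ

  _⋖_ : Carrier → Carrier → Set
  x ⋖ y = x ≼ y × x ≢ y × (∀ z → x ≼ z → z ≼ y → (z ≡ x) ⊎ (z ≡ y))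

record IsGradedFinPoset (P : RankedFinPoset) : Set where
  open RankedFinPoset P
  field
    elems-complete : ∀ x → x ∈ elems
    elems-unique   : Unique elems
    isPartialOrder : IsPartialOrder _≡_ _≼_
    rk-minimal     : ∀ x → (∀ y → y ≼ x → y ≡ x) → rk x ≡ 0
    rk-maximal     : ∀ x → (∀ y → x ≼ y → y ≡ x) → rk x ≡ rank
    rk-cover       : ∀ x y → x ⋖ y → rk y ≡ suc (rk x)

module Ops (P : RankedFinPoset) where
  open RankedFinPoset P

  Subset : Set
  Subset = Carrier → Bool

  _∈ₛ_ : Carrier → Subset → Set
  x ∈ₛ A = A x ≡ true

  IsAntichain : Subset → Set
  IsAntichain A = ∀ x y → x ∈ₛ A → y ∈ₛ A → x ≼ y → x ≡ y

  allB : (Carrier → Bool) → Bool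
  allB f = foldr (λ x b → f x ∧ b) true elems

  isAntichainᵇ : Subset → Bool
  isAntichainᵇ A = allB (λ x → allB (λ y →
     not (A x ∧ A y ∧ does (x ≼? y)) ∨ does (x ≟ y)))

  insert : Carrier → Subset → Subset
  insert p A y = A y ∨ does (y ≟ p)

  toggle : Carrier → Subset → Subset
  toggle p A x = if does (x ≟ p)
                 then (if A p then false else isAntichainᵇ (insert p A))
                 else A x

  τ : ℕ → Subset → Subset
  τ i A = foldr toggle A (filter (λ p → rk p Data.Nat.≟ i) elems)

  -- apply τ_{i₁}, then τ_{i₂}, ... (first list element applied first)
  applyRanks : List ℕ → Subset → Subset
  applyRanks []       A = A
  applyRanks (i ∷ is) A = applyRanks is (τ i A)

  ranksFrom : ℕ → List ℕ
  ranksFrom j = map (j +_) (upTo (suc rank ∸ j))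

  -- τ_r ⋯ τ_{j+1} τ_j
  seg : ℕ → Subset → Subset
  seg j = applyRanks (ranksFrom j)

  row : Subset → Subset
  row = seg 0

  -- row_A^{-1} = τ_0 τ_1 ⋯ τ_r  (each τ_i is an involution on antichains)
  rowInv : Subset → Subset
  rowInv = applyRanks (reverse (ranksFrom 0))

  -- rvac_A = (τ_r)(τ_r τ_{r-1}) ⋯ (τ_r ⋯ τ_1)(τ_r ⋯ τ_0)
  rvac : Subset → Subset
  rvac A = foldl (λ B j → seg j B) A (upTo (suc rank))

module _ (P : RankedFinPoset) where
  open RankedFinPoset P

  GeOne : Set
  GeOne = Σ Carrier (λ x → 1 ≤ rk x)

  private
    eqGeOne : DecidableEquality GeOne
    eqGeOne (x , h) (y , k) with x ≟ y
    ... | no x≢y = no (λ e → x≢y (cong proj₁ e))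
    ... | yes refl with ≤-irrelevant h k
    ...   | refl = yes refl

    pick : Carrier → Maybe GeOne
    pick x with 1 ≤? rk x
    ... | yes h = just (x , h)
    ... | no _  = nothing

  P≥1 : RankedFinPoset
  P≥1 = record
    { Carrier = GeOne
    ; _≟_     = eqGeOne
    ; elems   = mapMaybe pick elems
    ; _≼_     = λ a b → proj₁ a ≼ proj₁ b
    ; _≼?_    = λ a b → proj₁ a ≼? proj₁ b
    ; rank    = rank ∸ 1
    ; rk      = λ a → rk (proj₁ a) ∸ 1
    }

  restrict : Ops.Subset P → Ops.Subset P≥1
  restrict A a = A (proj₁ a)

-- An antichain B is encoded by the order ideals Ψ i B (the complement of the up-set of B
-- below rank i, the down-set of B from rank i on). They satisfy Ψ (i + 1) (τ i B) = Ψ i B and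
-- τᴶ i (Ψ i B) = Ψ (i + 1) B, where τᴶ i is the order-ideal toggle at rank i, so the down-set
-- Ψ 0 (rvac B) arises from Ψ 0 B by a word in the τᴶ i. Unlike τ i, the toggle τᴶ i only looks
-- at ranks i and i ± 1: toggles of ranks at distance ≥ 2 commute, and for i ≥ 2 they commute
-- with restriction to P≥1. Rearranging the word accordingly, on ranks ≥ 1 it becomes the word
-- computing the down-set of row⁻¹ (rvac Ā) in P≥1; since an antichain is the set of maximal
-- elements of its down-set, this gives (2). For (1), only the initial τ 0 of rvac acts on rank 0.

module Submission where

open import Defs
open import Data.Nat using (ℕ; _≤_)
open import Data.Product using (_×_; _,_; ∃)
open import Relation.Binary.PropositionalEquality using (_≡_)
open import Relation.Nullary using (¬_)
open import Function.Bundles using (_⇔_)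

open import Data.Bool as Bool using (Bool; true; false; not; _∧_; _∨_; _xor_; if_then_else_)
import Data.Bool.Properties as Bool
open import Data.List using (List; []; _∷_; foldr; foldl; map; upTo; applyUpTo; reverse; filter; length; mapMaybe)
open import Data.List.Properties using (map-applyUpTo; map-cong; map-id; foldl-ʳ++)
open import Data.List.Membership.Propositional using (_∈_; _∉_; lose)
open import Data.List.Membership.Propositional.Properties using (∈-filter⁺; ∈-filter⁻)
open import Data.List.Relation.Unary.All as All using (All; []; _∷_)
open import Data.List.Relation.Unary.All.Properties using (all-filter; map⁺; applyUpTo⁺₂)
open import Data.List.Relation.Unary.Any as Any using (Any; here; there)
open import Data.List.Relation.Unary.AllPairs using ([]; _∷_)
open import Data.List.Relation.Unary.Unique.Propositional using (Unique)
import Data.List.Relation.Unary.Unique.Propositional.Properties as Unique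
open import Data.Maybe using (Maybe; just; nothing)
open import Data.Nat as ℕ using (zero; suc; _<_; _≟_; _<?_; _∸_; _+_)
open import Data.Nat.Induction using (<-wellFounded)
import Data.Nat.Properties as ℕ
open import Data.List.Extrema ℕ.≤-totalOrder using (argmin; argmin-all; f[argmin]≤f[xs])
open import Data.Product using (Σ; proj₁; proj₂)
open import Data.Sum as Sum using (_⊎_; inj₁; inj₂)
open import Function.Base using (_∘_; _$_; flip; id)
open import Function.Bundles using (mk⇔; Equivalence)
import Function.Properties.Equivalence as ⇔
open import Induction.WellFounded using (Acc; acc)
open import Level using (0ℓ)
open import Relation.Binary.Definitions using (Decidable; tri<; tri≈; tri>)
import Relation.Binary.PropositionalEquality as ≡
open import Relation.Binary.PropositionalEquality using (refl; sym; trans; cong; cong₂; subst; _≢_; _≗_; module ≡-Reasoning)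
open import Relation.Binary.Structures using (IsPartialOrder)
open import Relation.Nullary using (Dec; yes; no; does; contradiction)
open import Relation.Nullary.Decidable using (dec-true; dec-false; does-≡; map′; _×-dec_; _→-dec_; ¬?)
open import Relation.Unary as U using (Pred)

open Equivalence using (to; from)

does⇔ : ∀ {A : Set} (a? : Dec A) → does a? ≡ true ⇔ A
does⇔ (yes a)  = mk⇔ (λ _ → a) (λ _ → refl)
does⇔ (no ¬a) = mk⇔ (λ ()) (λ a → contradiction a ¬a)

does-cong : ∀ {A B : Set} → A ⇔ B → (a? : Dec A) (b? : Dec B) → does a? ≡ does b?
does-cong A⇔B a? b? = does-≡ a? (map′ (from A⇔B) (to A⇔B) b?)

true-⇔⇒≡ : ∀ {a b} → a ≡ true ⇔ b ≡ true → a ≡ b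
true-⇔⇒≡ {false} {false} _ = refl
true-⇔⇒≡ {false} {true}  a⇔b = from a⇔b refl
true-⇔⇒≡ {true}  {false} a⇔b = sym (to a⇔b refl)
true-⇔⇒≡ {true}  {true}  _ = refl

foldr-∧⇔All : ∀ {A : Set} (f : A → Bool) xs →
              foldr (λ x b → f x ∧ b) true xs ≡ true ⇔ All (λ x → f x ≡ true) xs
foldr-∧⇔All f [] = mk⇔ (λ _ → []) (λ _ → refl)
foldr-∧⇔All f (x ∷ xs) with f x in fx
... | true  = mk⇔ (λ e → fx ∷ to (foldr-∧⇔All f xs) e) (λ { (_ ∷ all) → from (foldr-∧⇔All f xs) all })
... | false = mk⇔ (λ ()) (λ { (fx≡true ∷ _) → contradiction (trans (sym fx) fx≡true) λ () })

module _ {A : Set} {P Q : Pred A 0ℓ} (P? : U.Decidable P) (Q? : U.Decidable Q) (P⇒Q : ∀ {x} → P x → Q x) where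

  length-filter-mono : ∀ xs → length (filter P? xs) ≤ length (filter Q? xs)
  length-filter-mono [] = ℕ.z≤n
  length-filter-mono (x ∷ xs) with P? x | Q? x
  ... | yes _  | yes _  = ℕ.s≤s (length-filter-mono xs)
  ... | yes px | no ¬qx = contradiction (P⇒Q px) ¬qx
  ... | no _   | yes _  = ℕ.m≤n⇒m≤1+n (length-filter-mono xs)
  ... | no _   | no _   = length-filter-mono xs

  length-filter-< : ∀ {xs z} → z ∈ xs → ¬ P z → Q z → length (filter P? xs) < length (filter Q? xs)
  length-filter-< {x ∷ xs} (here refl) ¬pz qz with P? x | Q? x
  ... | yes pz | _     = contradiction pz ¬pz
  ... | no _   | yes _ = ℕ.s≤s (length-filter-mono xs)
  ... | no _   | no ¬qz = contradiction qz ¬qz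
  length-filter-< {x ∷ xs} (there z∈xs) ¬pz qz with P? x | Q? x
  ... | yes _  | yes _  = ℕ.s≤s (length-filter-< z∈xs ¬pz qz)
  ... | yes px | no ¬qx = contradiction (P⇒Q px) ¬qx
  ... | no _   | yes _  = ℕ.m<n⇒m<1+n (length-filter-< z∈xs ¬pz qz)
  ... | no _   | no _   = length-filter-< z∈xs ¬pz qz

∈-mapMaybe⁺ : ∀ {A B : Set} (f : A → Maybe B) {xs x y} → x ∈ xs → f x ≡ just y → y ∈ mapMaybe f xs
∈-mapMaybe⁺ f {x ∷ xs} (here refl) fx≡y rewrite fx≡y = here refl
∈-mapMaybe⁺ f {x′ ∷ xs} (there x∈xs) fx≡y with f x′
... | nothing = ∈-mapMaybe⁺ f x∈xs fx≡y
... | just _  = there (∈-mapMaybe⁺ f x∈xs fx≡y)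

∈-mapMaybe⁻ : ∀ {A B : Set} (f : A → Maybe B) {xs y} → y ∈ mapMaybe f xs → ∃ λ x → x ∈ xs × f x ≡ just y
∈-mapMaybe⁻ f {x ∷ xs} y∈ with f x in fx
∈-mapMaybe⁻ f {x ∷ xs} y∈           | nothing = let (x′ , x′∈xs , fx′) = ∈-mapMaybe⁻ f y∈ in x′ , there x′∈xs , fx′
∈-mapMaybe⁻ f {x ∷ xs} (here refl)  | just _  = x , here refl , fx
∈-mapMaybe⁻ f {x ∷ xs} (there y∈′) | just _  = let (x′ , x′∈xs , fx′) = ∈-mapMaybe⁻ f y∈′ in x′ , there x′∈xs , fx′

mapMaybe-unique : ∀ {A B : Set} (f : A → Maybe B) (g : B → A) → (∀ {x y} → f x ≡ just y → g y ≡ x) →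
                  ∀ {xs} → Unique xs → Unique (mapMaybe f xs)
mapMaybe-unique f g g-inverts {[]} [] = []
mapMaybe-unique f g g-inverts {x ∷ xs} (x∉xs ∷ xs-unique) with f x in fx
... | nothing = mapMaybe-unique f g g-inverts xs-unique
... | just y  = All.tabulate y-fresh ∷ mapMaybe-unique f g g-inverts xs-unique
  where
  y-fresh : ∀ {z} → z ∈ mapMaybe f xs → y ≢ z
  y-fresh z∈ refl with ∈-mapMaybe⁻ f z∈
  ... | x′ , x′∈xs , fx′ = All.lookup x∉xs x′∈xs (trans (sym (g-inverts fx)) (g-inverts fx′))

GeOne-≡ : ∀ P {a b : GeOne P} → proj₁ a ≡ proj₁ b → a ≡ b
GeOne-≡ P {x , h} {.x , k} refl = cong (x ,_) (ℕ.≤-irrelevant h k)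

module GradedFinPoset (P : RankedFinPoset) (graded : IsGradedFinPoset P) where
  open RankedFinPoset P renaming (_≟_ to _≟ₚ_)
  open IsGradedFinPoset graded
  open IsPartialOrder isPartialOrder using () renaming (refl to ≼-refl; trans to ≼-trans; antisym to ≼-antisym)
  open Ops P
  open import Data.List.Membership.DecPropositional _≟ₚ_ using () renaming (_∈?_ to _∈ᴸ?_)

  ∀? : {Q : Pred Carrier 0ℓ} → U.Decidable Q → Dec (∀ x → Q x)
  ∀? Q? = map′ (λ qs x → All.lookup qs (elems-complete x)) (λ q → All.tabulate (λ {x} _ → q x)) (All.all? Q? elems)

  ∃? : {Q : Pred Carrier 0ℓ} → U.Decidable Q → Dec (∃ Q)
  ∃? Q? = map′ Any.satisfied (λ (x , qx) → lose (elems-complete x) qx) (Any.any? Q? elems)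

  ∃-minimiser : (f : Carrier → ℕ) {Q : Pred Carrier 0ℓ} → U.Decidable Q → ∀ {s} → Q s →
                ∃ λ m → Q m × ∀ z → Q z → f m ≤ f z
  ∃-minimiser f Q? {s} qs =
    m , argmin-all f qs (all-filter Q? elems) ,
    λ z qz → All.lookup (f[argmin]≤f[xs] s (filter Q? elems)) (∈-filter⁺ Q? (elems-complete z) qz)
    where m = argmin f s (filter Q? elems)

  _≺_ : Carrier → Carrier → Set
  x ≺ y = x ≼ y × x ≢ y

  _≺?_ : Decidable _≺_
  x ≺? y = (x ≼? y) ×-dec ¬? (x ≟ₚ y)

  ≺-trans : ∀ {x y z} → x ≺ y → y ≼ z → x ≺ z
  ≺-trans (x≼y , x≢y) y≼z = ≼-trans x≼y y≼z , λ { refl → x≢y (≼-antisym x≼y y≼z) }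

  below above : Carrier → ℕ
  below y = length (filter (_≺? y) elems)
  above x = length (filter (x ≺?_) elems)

  below-mono : ∀ {x y} → x ≺ y → below x < below y
  below-mono {x} {y} x≺y =
    length-filter-< (_≺? x) (_≺? y) (λ z≺x → ≺-trans z≺x (proj₁ x≺y)) (elems-complete x) (λ (_ , x≢x) → x≢x refl) x≺y

  above-mono : ∀ {x y} → x ≺ y → above y < above x
  above-mono {x} {y} x≺y =
    length-filter-< (y ≺?_) (x ≺?_) (λ y≺z → ≺-trans x≺y (proj₁ y≺z)) (elems-complete y) (λ (_ , y≢y) → y≢y refl) x≺y

  cover-above : ∀ {x y} → x ≺ y → ∃ λ z → x ⋖ z × z ≼ y
  cover-above {x} {y} x≺y with ∃-minimiser below (λ w → (x ≺? w) ×-dec (w ≼? y)) (x≺y , ≼-refl)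
  ... | z , (x≺z , z≼y) , least = z , (proj₁ x≺z , proj₂ x≺z , between) , z≼y
    where
    between : ∀ w → x ≼ w → w ≼ z → w ≡ x ⊎ w ≡ z
    between w x≼w w≼z with w ≟ₚ x | w ≟ₚ z
    ... | yes w≡x | _ = inj₁ w≡x
    ... | no _ | yes w≡z = inj₂ w≡z
    ... | no w≢x | no w≢z = contradiction (least w ((x≼w , w≢x ∘ sym) , ≼-trans w≼z z≼y)) (ℕ.<⇒≱ (below-mono (w≼z , w≢z)))

  cover-below : ∀ {x y} → x ≺ y → ∃ λ z → x ≼ z × z ⋖ y
  cover-below {x} {y} x≺y with ∃-minimiser above (λ w → (x ≼? w) ×-dec (w ≺? y)) (≼-refl , x≺y)
  ... | z , (x≼z , z≺y) , least = z , x≼z , (proj₁ z≺y , proj₂ z≺y , between)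
    where
    between : ∀ w → z ≼ w → w ≼ y → w ≡ z ⊎ w ≡ y
    between w z≼w w≼y with w ≟ₚ z | w ≟ₚ y
    ... | yes w≡z | _ = inj₁ w≡z
    ... | no _ | yes w≡y = inj₂ w≡y
    ... | no w≢z | no w≢y = contradiction (least w (≼-trans x≼z z≼w , w≼y , w≢y)) (ℕ.<⇒≱ (above-mono (z≼w , w≢z ∘ sym)))

  rk-strict : ∀ {x y} → x ≺ y → rk x < rk y
  rk-strict {y = y} = go (<-wellFounded (below y))
    where
    go : ∀ {x y} → Acc _<_ (below y) → x ≺ y → rk x < rk y
    go {x} (acc rec) x≺y with cover-below x≺y
    ... | z , x≼z , z⋖y@(z≼y , z≢y , _) with x ≟ₚ z
    ... | yes refl = ℕ.≤-reflexive (sym (rk-cover x _ z⋖y))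
    ... | no x≢z = ℕ.<-trans (go (rec (below-mono (z≼y , z≢y))) (x≼z , x≢z)) (ℕ.≤-reflexive (sym (rk-cover z _ z⋖y)))

  rk-mono : ∀ {x y} → x ≼ y → rk x ≤ rk y
  rk-mono {x} {y} x≼y with x ≟ₚ y
  ... | yes refl = ℕ.≤-refl
  ... | no x≢y = ℕ.<⇒≤ (rk-strict (x≼y , x≢y))

  ≼-same-rank : ∀ {x y} → x ≼ y → rk x ≡ rk y → x ≡ y
  ≼-same-rank {x} {y} x≼y rx≡ry with x ≟ₚ y
  ... | yes x≡y = x≡y
  ... | no x≢y = contradiction rx≡ry (ℕ.<⇒≢ (rk-strict (x≼y , x≢y)))

  step-above : ∀ {x y} → x ≺ y → ∃ λ z → x ≺ z × z ≼ y × rk z ≡ suc (rk x)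
  step-above x≺y with cover-above x≺y
  ... | z , x⋖z@(x≼z , x≢z , _) , z≼y = z , (x≼z , x≢z) , z≼y , rk-cover _ z x⋖z

  step-below : ∀ {x y} → x ≺ y → ∃ λ z → x ≼ z × z ≺ y × suc (rk z) ≡ rk y
  step-below x≺y with cover-below x≺y
  ... | z , x≼z , z⋖y@(z≼y , z≢y , _) = z , x≼z , (z≼y , z≢y) , sym (rk-cover z _ z⋖y)

  -- Antichain toggles

  allB⇔ : ∀ {f} → allB f ≡ true ⇔ (∀ x → f x ≡ true)
  allB⇔ {f} = mk⇔ (λ e x → All.lookup (to (foldr-∧⇔All f elems) e) (elems-complete x))
                  (λ h → from (foldr-∧⇔All f elems) (All.tabulate λ {x} _ → h x))

  antichain-pair⇔ : ∀ (A : Subset) x y →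
                    (not (A x ∧ A y ∧ does (x ≼? y)) ∨ does (x ≟ₚ y)) ≡ true ⇔ (x ∈ₛ A → y ∈ₛ A → x ≼ y → x ≡ y)
  antichain-pair⇔ A x y with A x | A y | x ≼? y | x ≟ₚ y
  ... | true  | true  | yes x≼y  | no x≢y  = mk⇔ (λ ()) (λ h → contradiction (h refl refl x≼y) x≢y)
  ... | true  | true  | yes _    | yes x≡y = mk⇔ (λ _ _ _ _ → x≡y) (λ _ → refl)
  ... | true  | true  | no ¬x≼y | _       = mk⇔ (λ _ _ _ x≼y → contradiction x≼y ¬x≼y) (λ _ → refl)
  ... | true  | false | _        | _       = mk⇔ (λ _ _ ()) (λ _ → refl)
  ... | false | _     | _        | _       = mk⇔ (λ _ ()) (λ _ → refl)

  isAntichainᵇ⇔ : ∀ A → isAntichainᵇ A ≡ true ⇔ IsAntichain A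
  isAntichainᵇ⇔ A = mk⇔
    (λ e x y → to (antichain-pair⇔ A x y) (to allB⇔ (to allB⇔ e x) y))
    (λ h → from allB⇔ λ x → from allB⇔ λ y → from (antichain-pair⇔ A x y) (h x y))

  ∈-insert⁻ : ∀ {p S w} → w ∈ₛ insert p S → w ∈ₛ S ⊎ w ≡ p
  ∈-insert⁻ {p} {S} {w} w∈ with S w | w ≟ₚ p
  ... | true  | _       = inj₁ refl
  ... | false | yes w≡p = inj₂ w≡p

  ∈-insert-self : ∀ p S → p ∈ₛ insert p S
  ∈-insert-self p S rewrite dec-true (p ≟ₚ p) refl = Bool.∨-zeroʳ (S p)

  ∈-insert-⊇ : ∀ p S {w} → w ∈ₛ S → w ∈ₛ insert p S
  ∈-insert-⊇ p S w∈S rewrite w∈S = refl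

  toggle-self : ∀ p C → toggle p C p ≡ (if C p then false else isAntichainᵇ (insert p C))
  toggle-self p C rewrite dec-true (p ≟ₚ p) refl = refl

  toggle-≢ : ∀ {p C x} → x ≢ p → toggle p C x ≡ C x
  toggle-≢ {p} {C} {x} x≢p rewrite dec-false (x ≟ₚ p) x≢p = refl

  toggles-elsewhere : ∀ {B x} ps → x ∉ ps → foldr toggle B ps x ≡ B x
  toggles-elsewhere [] _ = refl
  toggles-elsewhere (p ∷ ps) x∉ = trans (toggle-≢ (x∉ ∘ here)) (toggles-elsewhere ps (x∉ ∘ there))

  τ-elsewhere : ∀ {i B x} → rk x ≢ i → τ i B x ≡ B x
  τ-elsewhere {i} {x = x} rx≢i = toggles-elsewhere _ (rx≢i ∘ proj₂ ∘ ∈-filter⁻ (λ p → rk p ≟ i) {xs = elems})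

  infix 4 _∈↑_ _∈↓_
  _∈↑_ _∈↓_ : Carrier → Subset → Set
  x ∈↑ B = ∃ λ b → b ∈ₛ B × b ≼ x
  x ∈↓ B = ∃ λ b → b ∈ₛ B × x ≼ b

  _∈↑?_ : ∀ x B → Dec (x ∈↑ B)
  x ∈↑? B = ∃? λ b → (B b Bool.≟ true) ×-dec (b ≼? x)

  _∈↓?_ : ∀ x B → Dec (x ∈↓ B)
  x ∈↓? B = ∃? λ b → (B b Bool.≟ true) ×-dec (x ≼? b)

  upset downset : Subset → Subset
  upset B x = does (x ∈↑? B)
  downset B x = does (x ∈↓? B)

  Free : Subset → Carrier → Set
  Free B x = ¬ x ∈↑ B × ¬ x ∈↓ B

  free? : ∀ B x → Dec (Free B x)
  free? B x = ¬? (x ∈↑? B) ×-dec ¬? (x ∈↓? B)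

  FreeOfRank : ℕ → Subset → Carrier → Set
  FreeOfRank i B w = rk w ≡ i × Free B w

  classified-isAntichain : ∀ {i B S} → IsAntichain B → (∀ w → w ∈ₛ S → w ∈ₛ B ⊎ FreeOfRank i B w) →
                           IsAntichain S
  classified-isAntichain {B = B} B-anti classify u v u∈S v∈S u≼v with classify u u∈S | classify v v∈S
  ... | inj₁ u∈B         | inj₁ v∈B         = B-anti u v u∈B v∈B u≼v
  ... | inj₁ u∈B         | inj₂ (_ , v-free) = contradiction (u , u∈B , u≼v) (proj₁ v-free)
  ... | inj₂ (_ , u-free) | inj₁ v∈B         = contradiction (v , v∈B , u≼v) (proj₂ u-free)
  ... | inj₂ (ru , _)    | inj₂ (rv , _)    = ≼-same-rank u≼v (trans ru (sym rv))

  insert-isAntichain⇒Free : ∀ {i B S x} → rk x ≡ i → ¬ x ∈ₛ B → (∀ b → b ∈ₛ B → rk b ≢ i → b ∈ₛ S) →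
                            IsAntichain (insert x S) → Free B x
  insert-isAntichain⇒Free {i} {B} {S} {x} rx x∉B B⊆S anti =
    (λ (b , b∈B , b≼x) → x∉B (subst (_∈ₛ B) (comparable⇒≡ b∈B (inj₁ b≼x)) b∈B)) ,
    (λ (b , b∈B , x≼b) → x∉B (subst (_∈ₛ B) (comparable⇒≡ b∈B (inj₂ x≼b)) b∈B))
    where
    comparable⇒≡ : ∀ {b} → b ∈ₛ B → b ≼ x ⊎ x ≼ b → b ≡ x
    comparable⇒≡ {b} b∈B cmp with rk b ≟ i | cmp
    ... | yes rb | inj₁ b≼x = ≼-same-rank b≼x (trans rb (sym rx))
    ... | yes rb | inj₂ x≼b = sym (≼-same-rank x≼b (trans rx (sym rb)))
    ... | no rb  | inj₁ b≼x = anti b x (∈-insert-⊇ x S (B⊆S b b∈B rb)) (∈-insert-self x S) b≼x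
    ... | no rb  | inj₂ x≼b = sym (anti x b (∈-insert-self x S) (∈-insert-⊇ x S (B⊆S b b∈B rb)) x≼b)

  toggle-at-free : ∀ {i B C p} → IsAntichain B → rk p ≡ i → C p ≡ B p →
                   (∀ w → rk w ≢ i → C w ≡ B w) → (∀ w → w ∈ₛ C → w ∈ₛ B ⊎ FreeOfRank i B w) →
                   toggle p C p ≡ does (free? B p)
  toggle-at-free {i} {B} {C} {p} B-anti rp Cp≡Bp C-off C-classified
    rewrite toggle-self p C | Cp≡Bp with B p in p∈B
  ... | true  = sym (dec-false (free? B p) λ (p∉↑ , _) → p∉↑ (p , p∈B , ≼-refl))
  ... | false = true-⇔⇒≡ (mk⇔
    (λ e → from (does⇔ (free? B p))
       (insert-isAntichain⇒Free rp (λ p∈B′ → contradiction (trans (sym p∈B) p∈B′) λ ())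
          (λ b b∈B rb → trans (C-off b rb) b∈B) (to (isAntichainᵇ⇔ _) e)))
    (λ e → from (isAntichainᵇ⇔ _) (classified-isAntichain B-anti (classify (to (does⇔ (free? B p)) e)))))
    where
    classify : Free B p → ∀ w → w ∈ₛ insert p C → w ∈ₛ B ⊎ FreeOfRank i B w
    classify p-free w w∈ with ∈-insert⁻ {p} {C} w∈
    ... | inj₁ w∈C  = C-classified w w∈C
    ... | inj₂ refl = inj₂ (rp , p-free)

  toggles-of-rank : ∀ {i B} → IsAntichain B → ∀ {ps} → All (λ p → rk p ≡ i) ps → Unique ps →
                    ∀ {x} → x ∈ ps → foldr toggle B ps x ≡ does (free? B x)
  toggles-of-rank {i} {B} B-anti {p ∷ ps} (rp ∷ rps) (p∉ps ∷ ps-unique) (here refl) =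
    toggle-at-free B-anti rp (toggles-elsewhere ps p∉ps′)
      (λ w rw → toggles-elsewhere ps (λ w∈ps → rw (All.lookup rps w∈ps))) classify
    where
    p∉ps′ : p ∉ ps
    p∉ps′ p∈ps = All.lookup p∉ps p∈ps refl
    classify : ∀ w → w ∈ₛ foldr toggle B ps → w ∈ₛ B ⊎ FreeOfRank i B w
    classify w w∈ with w ∈ᴸ? ps
    ... | yes w∈ps = inj₂ (All.lookup rps w∈ps ,
                           to (does⇔ (free? B w)) (trans (sym (toggles-of-rank B-anti rps ps-unique w∈ps)) w∈))
    ... | no w∉ps  = inj₁ (trans (sym (toggles-elsewhere ps w∉ps)) w∈)
  toggles-of-rank B-anti {p ∷ ps} (_ ∷ rps) (p∉ps ∷ ps-unique) {x} (there x∈ps) =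
    trans (toggle-≢ x≢p) (toggles-of-rank B-anti rps ps-unique x∈ps)
    where
    x≢p : x ≢ p
    x≢p refl = All.lookup p∉ps x∈ps refl

  τ-at-rank : ∀ {i B x} → IsAntichain B → rk x ≡ i → τ i B x ≡ does (free? B x)
  τ-at-rank {i} B-anti rx = toggles-of-rank B-anti (all-filter (λ p → rk p ≟ i) elems)
    (Unique.filter⁺ (λ p → rk p ≟ i) elems-unique) (∈-filter⁺ (λ p → rk p ≟ i) (elems-complete _) rx)

  τ-isAntichain : ∀ {i B} → IsAntichain B → IsAntichain (τ i B)
  τ-isAntichain {i} {B} B-anti = classified-isAntichain B-anti classify
    where
    classify : ∀ w → w ∈ₛ τ i B → w ∈ₛ B ⊎ FreeOfRank i B w
    classify w w∈ with rk w ≟ i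
    ... | yes rw = inj₂ (rw , to (does⇔ (free? B w)) (trans (sym (τ-at-rank B-anti rw)) w∈))
    ... | no rw  = inj₁ (trans (sym (τ-elsewhere rw)) w∈)

  -- Order-ideal toggles

  Toggleable : Subset → Carrier → Set
  Toggleable X x = (∀ y → y ≼ x → suc (rk y) ≡ rk x → y ∈ₛ X) × (∀ y → x ≼ y → rk y ≡ suc (rk x) → ¬ y ∈ₛ X)

  toggleable? : ∀ X x → Dec (Toggleable X x)
  toggleable? X x =
    ∀? (λ y → (y ≼? x) →-dec (suc (rk y) ≟ rk x) →-dec (X y Bool.≟ true)) ×-dec
    ∀? (λ y → (x ≼? y) →-dec (rk y ≟ suc (rk x)) →-dec ¬? (X y Bool.≟ true))

  -- Covers are detected through ranks, which is equivalent in a graded poset and makes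
  -- τᴶ i X x depend on X only at x and at ranks rk x ± 1.
  τᴶ : ℕ → Subset → Subset
  τᴶ i X x = if does (rk x ≟ i) then X x xor does (toggleable? X x) else X x

  τᴶ-at : ∀ {i} X {x} → rk x ≡ i → τᴶ i X x ≡ X x xor does (toggleable? X x)
  τᴶ-at {i} X {x} rx rewrite dec-true (rk x ≟ i) rx = refl

  τᴶ-elsewhere : ∀ {i} X {x} → rk x ≢ i → τᴶ i X x ≡ X x
  τᴶ-elsewhere {i} X {x} rx rewrite dec-false (rk x ≟ i) rx = refl

  Adjacent : Carrier → Carrier → Set
  Adjacent x y = suc (rk y) ≡ rk x ⊎ rk y ≡ suc (rk x)

  adjacent-≢ : ∀ {x y} → Adjacent x y → rk y ≢ rk x
  adjacent-≢ (inj₁ ry) r = ℕ.1+n≢n (trans ry (sym r))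
  adjacent-≢ (inj₂ ry) r = ℕ.1+n≢n (trans (sym ry) r)

  adjacent-≤ : ∀ {x y} → Adjacent x y → rk y ≤ suc (rk x)
  adjacent-≤ (inj₁ ry) = ℕ.m≤n⇒m≤1+n (ℕ.<⇒≤ (ℕ.≤-reflexive ry))
  adjacent-≤ (inj₂ ry) = ℕ.≤-reflexive ry

  adjacent-≥ : ∀ {x y} → Adjacent x y → rk x ≤ suc (rk y)
  adjacent-≥ (inj₁ ry) = ℕ.≤-reflexive (sym ry)
  adjacent-≥ (inj₂ ry) = ℕ.m≤n⇒m≤1+n (ℕ.<⇒≤ (ℕ.≤-reflexive (sym ry)))

  toggleable-transfer : ∀ {X Y x} → (∀ y → Adjacent x y → X y ≡ Y y) → Toggleable X x → Toggleable Y x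
  toggleable-transfer agree (lower , upper) =
    (λ y y≼x ry → trans (sym (agree y (inj₁ ry))) (lower y y≼x ry)) ,
    (λ y x≼y ry → upper y x≼y ry ∘ trans (agree y (inj₂ ry)))

  toggleable-local : ∀ {X Y x} → (∀ y → Adjacent x y → X y ≡ Y y) →
                     does (toggleable? X x) ≡ does (toggleable? Y x)
  toggleable-local {X} {Y} {x} agree =
    does-cong (mk⇔ (toggleable-transfer agree) (toggleable-transfer (λ y adj → sym (agree y adj))))
      (toggleable? X x) (toggleable? Y x)

  τᴶ-local : ∀ i {X Y x} → X x ≡ Y x → (∀ y → Adjacent x y → X y ≡ Y y) → τᴶ i X x ≡ τᴶ i Y x
  τᴶ-local i {X} {Y} {x} Xx≡Yx agree with rk x ≟ i
  ... | yes rx = trans (τᴶ-at X rx) (trans (cong₂ _xor_ Xx≡Yx (toggleable-local agree)) (sym (τᴶ-at Y rx)))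
  ... | no rx  = trans (τᴶ-elsewhere X rx) (trans Xx≡Yx (sym (τᴶ-elsewhere Y rx)))

  τᴶ-cong : ∀ i {X Y} → X ≗ Y → τᴶ i X ≗ τᴶ i Y
  τᴶ-cong i X≗Y x = τᴶ-local i (X≗Y x) (λ y _ → X≗Y y)

  τᴶ-involutive : ∀ i X → τᴶ i (τᴶ i X) ≗ X
  τᴶ-involutive i X x with rk x ≟ i
  ... | no rx  = trans (τᴶ-elsewhere (τᴶ i X) rx) (τᴶ-elsewhere X rx)
  ... | yes rx = begin
    τᴶ i (τᴶ i X) x                                       ≡⟨ τᴶ-at (τᴶ i X) rx ⟩
    τᴶ i X x xor does (toggleable? (τᴶ i X) x)            ≡⟨ cong₂ _xor_ (τᴶ-at X rx) (toggleable-local neighbours) ⟩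
    (X x xor does (toggleable? X x)) xor does (toggleable? X x) ≡⟨ Bool.xor-assoc (X x) _ _ ⟩
    X x xor (does (toggleable? X x) xor does (toggleable? X x)) ≡⟨ cong (X x xor_) (Bool.xor-same (does (toggleable? X x))) ⟩
    X x xor false                                          ≡⟨ Bool.xor-identityʳ (X x) ⟩
    X x                                                    ∎
    where
    open ≡-Reasoning
    neighbours : ∀ y → Adjacent x y → τᴶ i X y ≡ X y
    neighbours y adj = τᴶ-elsewhere X (adjacent-≢ adj ∘ flip trans (sym rx))

  τᴶ-comm : ∀ {i j} → suc i < j → ∀ X → τᴶ i (τᴶ j X) ≗ τᴶ j (τᴶ i X)
  τᴶ-comm {i} {j} i+1<j X x with rk x ≟ i | rk x ≟ j
  ... | yes ri | _ =
    trans (τᴶ-local i (τᴶ-elsewhere X rx≢j) (λ y adj → τᴶ-elsewhere X (ry≢j adj))) (sym (τᴶ-elsewhere (τᴶ i X) rx≢j))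
    where
    rx≢j : rk x ≢ j
    rx≢j = ℕ.<⇒≢ (ℕ.<-trans (ℕ.≤-reflexive (cong suc ri)) i+1<j)
    ry≢j : ∀ {y} → Adjacent x y → rk y ≢ j
    ry≢j adj = ℕ.<⇒≢ (ℕ.≤-<-trans (adjacent-≤ adj) (subst (λ n → suc n < j) (sym ri) i+1<j))
  ... | no ri | yes rj =
    trans (τᴶ-elsewhere (τᴶ j X) ri) (τᴶ-local j (sym (τᴶ-elsewhere X ri)) (λ y adj → sym (τᴶ-elsewhere X (ry≢i adj))))
    where
    ry≢i : ∀ {y} → Adjacent x y → rk y ≢ i
    ry≢i adj ry = ℕ.<⇒≱ i+1<j (ℕ.≤-trans (ℕ.≤-reflexive (sym rj)) (subst (λ n → rk x ≤ suc n) ry (adjacent-≥ adj)))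
  ... | no ri | no rj =
    trans (τᴶ-elsewhere (τᴶ j X) ri) (trans (τᴶ-elsewhere X rj)
      (sym (trans (τᴶ-elsewhere (τᴶ i X) rj) (τᴶ-elsewhere X ri))))

  Ψ : ℕ → Subset → Subset
  Ψ i B x = if does (rk x <? i) then not (upset B x) else downset B x

  Ψ-below : ∀ {i} B {x} → rk x < i → Ψ i B x ≡ not (upset B x)
  Ψ-below {i} B {x} rx<i rewrite dec-true (rk x <? i) rx<i = refl

  Ψ-above : ∀ {i} B {x} → i ≤ rk x → Ψ i B x ≡ downset B x
  Ψ-above {i} B {x} i≤rx rewrite dec-false (rk x <? i) (ℕ.≤⇒≯ i≤rx) = refl

  Ψ-suc : ∀ {i} B {x} → rk x ≢ i → Ψ (suc i) B x ≡ Ψ i B x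
  Ψ-suc {i} B {x} rx≢i with ℕ.<-cmp (rk x) i
  ... | tri< rx<i _ _ = trans (Ψ-below B (ℕ.m<n⇒m<1+n rx<i)) (sym (Ψ-below B rx<i))
  ... | tri≈ _ rx≡i _ = contradiction rx≡i rx≢i
  ... | tri> _ _ rx>i = trans (Ψ-above B rx>i) (sym (Ψ-above B (ℕ.<⇒≤ rx>i)))

  upset-local : ∀ {B C x} → (∀ b → b ≼ x → B b ≡ C b) → upset B x ≡ upset C x
  upset-local {B} {C} {x} agree = does-cong
    (mk⇔ (λ (b , b∈B , b≼x) → b , trans (sym (agree b b≼x)) b∈B , b≼x)
         (λ (b , b∈C , b≼x) → b , trans (agree b b≼x) b∈C , b≼x))
    (x ∈↑? B) (x ∈↑? C)

  downset-local : ∀ {B C x} → (∀ b → x ≼ b → B b ≡ C b) → downset B x ≡ downset C x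
  downset-local {B} {C} {x} agree = does-cong
    (mk⇔ (λ (b , b∈B , x≼b) → b , trans (sym (agree b x≼b)) b∈B , x≼b)
         (λ (b , b∈C , x≼b) → b , trans (agree b x≼b) b∈C , x≼b))
    (x ∈↓? B) (x ∈↓? C)

  ∈↓∩∈↑⇒∈ : ∀ {B x} → IsAntichain B → x ∈↓ B → x ∈↑ B → x ∈ₛ B
  ∈↓∩∈↑⇒∈ {B} B-anti (b , b∈B , x≼b) (b′ , b′∈B , b′≼x) with B-anti b′ b b′∈B b∈B (≼-trans b′≼x x≼b)
  ... | refl = subst (_∈ₛ B) (≼-antisym b′≼x x≼b) b′∈B

  Isolated : Subset → Carrier → Set
  Isolated B x = (∀ y → y ≺ x → ¬ y ∈↑ B) × (∀ y → x ≺ y → ¬ y ∈↓ B)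

  ∈-isolated : ∀ {B x} → IsAntichain B → x ∈ₛ B → Isolated B x
  ∈-isolated B-anti x∈B =
    (λ y (y≼x , y≢x) (b , b∈B , b≼y) →
       y≢x (≼-antisym y≼x (subst (_≼ y) (B-anti b _ b∈B x∈B (≼-trans b≼y y≼x)) b≼y))) ,
    (λ y (x≼y , x≢y) (b , b∈B , y≼b) →
       x≢y (≼-antisym x≼y (subst (y ≼_) (sym (B-anti _ b x∈B b∈B (≼-trans x≼y y≼b))) y≼b)))

  free-isolated : ∀ {B x} → Free B x → Isolated B x
  free-isolated (x∉↑ , x∉↓) =
    (λ y (y≼x , _) (b , b∈B , b≼y) → x∉↑ (b , b∈B , ≼-trans b≼y y≼x)) ,
    (λ y (x≼y , _) (b , b∈B , y≼b) → x∉↓ (b , b∈B , ≼-trans x≼y y≼b))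

  toggleable-Ψ : ∀ {i B x} → rk x ≡ i → Isolated B x → Toggleable (Ψ i B) x
  toggleable-Ψ {i} {B} {x} rx (lower , upper) =
    (λ y y≼x ry → trans (Ψ-below B (ℕ.≤-reflexive (trans ry rx)))
                        (cong not (dec-false (y ∈↑? B) (lower y (y≼x , λ { refl → ℕ.1+n≢n ry }))))) ,
    (λ y x≼y ry y∈Ψ → upper y (x≼y , λ { refl → ℕ.1+n≢n (sym ry) })
       (to (does⇔ (y ∈↓? B)) (trans (sym (Ψ-above B (i≤ ry))) y∈Ψ)))
    where
    i≤ : ∀ {y} → rk y ≡ suc (rk x) → i ≤ rk y
    i≤ ry = ℕ.≤-trans (ℕ.n≤1+n i) (ℕ.≤-reflexive (sym (trans ry (cong suc rx))))

  ¬toggleable-Ψ-∈↓ : ∀ {i B x} → rk x ≡ i → x ∈↓ B → ¬ x ∈↑ B → ¬ Toggleable (Ψ i B) x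
  ¬toggleable-Ψ-∈↓ {i} {B} {x} rx (b , b∈B , x≼b) x∉↑ (_ , upper) with x ≟ₚ b
  ... | yes refl = x∉↑ (x , b∈B , ≼-refl)
  ... | no x≢b with step-above (x≼b , x≢b)
  ...   | z , (x≼z , _) , z≼b , rz = upper z x≼z rz
          (trans (Ψ-above B (ℕ.≤-trans (ℕ.n≤1+n i) (ℕ.≤-reflexive (sym (trans rz (cong suc rx))))))
                 (from (does⇔ (z ∈↓? B)) (b , b∈B , z≼b)))

  ¬toggleable-Ψ-∈↑ : ∀ {i B x} → rk x ≡ i → x ∈↑ B → ¬ x ∈↓ B → ¬ Toggleable (Ψ i B) x
  ¬toggleable-Ψ-∈↑ {i} {B} {x} rx (b , b∈B , b≼x) x∉↓ (lower , _) with b ≟ₚ x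
  ... | yes refl = x∉↓ (b , b∈B , ≼-refl)
  ... | no b≢x with step-below (b≼x , b≢x)
  ...   | z , b≼z , (z≼x , _) , rz =
          contradiction (trans (sym (lower z z≼x rz)) (trans (Ψ-below B (ℕ.≤-reflexive (trans rz rx)))
                                                               (cong not (from (does⇔ (z ∈↑? B)) (b , b∈B , b≼z)))))
                        λ ()

  τᴶ-Ψ : ∀ {i B} → IsAntichain B → τᴶ i (Ψ i B) ≗ Ψ (suc i) B
  τᴶ-Ψ {i} {B} B-anti x with rk x ≟ i
  ... | no rx  = trans (τᴶ-elsewhere (Ψ i B) rx) (sym (Ψ-suc B rx))
  ... | yes rx = begin
    τᴶ i (Ψ i B) x                                         ≡⟨ τᴶ-at (Ψ i B) rx ⟩
    Ψ i B x xor does (toggleable? (Ψ i B) x)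
      ≡⟨ cong (_xor does (toggleable? (Ψ i B) x)) (Ψ-above B (ℕ.≤-reflexive (sym rx))) ⟩
    does (x ∈↓? B) xor does (toggleable? (Ψ i B) x)        ≡⟨ at-rank (x ∈↓? B) (x ∈↑? B) ⟩
    not (does (x ∈↑? B))                                   ≡⟨ sym (Ψ-below B (ℕ.≤-reflexive (cong suc rx))) ⟩
    Ψ (suc i) B x                                          ∎
    where
    open ≡-Reasoning
    at-rank : (x∈↓? : Dec (x ∈↓ B)) (x∈↑? : Dec (x ∈↑ B)) →
              does x∈↓? xor does (toggleable? (Ψ i B) x) ≡ not (does x∈↑?)
    at-rank (yes x∈↓) (yes x∈↑) = cong not (dec-true (toggleable? (Ψ i B) x)
                                     (toggleable-Ψ rx (∈-isolated B-anti (∈↓∩∈↑⇒∈ B-anti x∈↓ x∈↑))))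
    at-rank (yes x∈↓) (no x∉↑)  = cong not (dec-false (toggleable? (Ψ i B) x) (¬toggleable-Ψ-∈↓ rx x∈↓ x∉↑))
    at-rank (no x∉↓)  (yes x∈↑) = dec-false (toggleable? (Ψ i B) x) (¬toggleable-Ψ-∈↑ rx x∈↑ x∉↓)
    at-rank (no x∉↓)  (no x∉↑)  = dec-true (toggleable? (Ψ i B) x) (toggleable-Ψ rx (free-isolated (x∉↑ , x∉↓)))

  ∈↓-τ⇔∉↑ : ∀ {i B x} → IsAntichain B → rk x ≡ i → x ∈↓ τ i B ⇔ (¬ x ∈↑ B)
  ∈↓-τ⇔∉↑ {i} {B} {x} B-anti rx = mk⇔ ⇒ ⇐
    where
    higher-in-τ : ∀ {b} → x ≼ b → x ≢ b → τ i B b ≡ B b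
    higher-in-τ x≼b x≢b = τ-elsewhere (λ rb → ℕ.<⇒≢ (rk-strict (x≼b , x≢b)) (trans rx (sym rb)))
    ⇒ : x ∈↓ τ i B → ¬ x ∈↑ B
    ⇒ (b , b∈τB , x≼b) with x ≟ₚ b
    ... | yes refl = proj₁ (to (does⇔ (free? B x)) (trans (sym (τ-at-rank B-anti rx)) b∈τB))
    ... | no x≢b = λ (b′ , b′∈B , b′≼x) →
      let b∈B = trans (sym (higher-in-τ x≼b x≢b)) b∈τB
      in x≢b (≼-antisym x≼b (subst (_≼ x) (B-anti b′ b b′∈B b∈B (≼-trans b′≼x x≼b)) b′≼x))
    ⇐ : ¬ x ∈↑ B → x ∈↓ τ i B
    ⇐ x∉↑ with x ∈↓? B
    ... | yes (b , b∈B , x≼b) =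
      b , trans (higher-in-τ x≼b (λ { refl → x∉↑ (x , b∈B , ≼-refl) })) b∈B , x≼b
    ... | no x∉↓ = x , trans (τ-at-rank B-anti rx) (dec-true (free? B x) (x∉↑ , x∉↓)) , ≼-refl

  Ψ-τ : ∀ {i B} → IsAntichain B → Ψ i (τ i B) ≗ Ψ (suc i) B
  Ψ-τ {i} {B} B-anti x with ℕ.<-cmp (rk x) i
  ... | tri< rx<i _ _ = begin
    Ψ i (τ i B) x          ≡⟨ Ψ-below (τ i B) rx<i ⟩
    not (upset (τ i B) x)  ≡⟨ cong not (upset-local λ b b≼x → τ-elsewhere (ℕ.<⇒≢ (ℕ.≤-<-trans (rk-mono b≼x) rx<i))) ⟩
    not (upset B x)        ≡⟨ sym (Ψ-below B (ℕ.m<n⇒m<1+n rx<i)) ⟩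
    Ψ (suc i) B x          ∎
    where open ≡-Reasoning
  ... | tri> _ _ rx>i = begin
    Ψ i (τ i B) x          ≡⟨ Ψ-above (τ i B) (ℕ.<⇒≤ rx>i) ⟩
    downset (τ i B) x      ≡⟨ downset-local (λ b x≼b → τ-elsewhere (ℕ.<⇒≢ (ℕ.<-≤-trans rx>i (rk-mono x≼b)) ∘ sym)) ⟩
    downset B x            ≡⟨ sym (Ψ-above B rx>i) ⟩
    Ψ (suc i) B x          ∎
    where open ≡-Reasoning
  ... | tri≈ _ rx≡i _ = begin
    Ψ i (τ i B) x          ≡⟨ Ψ-above (τ i B) (ℕ.≤-reflexive (sym rx≡i)) ⟩
    downset (τ i B) x      ≡⟨ does-cong (∈↓-τ⇔∉↑ B-anti rx≡i) (x ∈↓? τ i B) (¬? (x ∈↑? B)) ⟩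
    not (upset B x)        ≡⟨ sym (Ψ-below B (ℕ.≤-reflexive (cong suc rx≡i))) ⟩
    Ψ (suc i) B x          ∎
    where open ≡-Reasoning

  Ψ-suc-τ : ∀ {i B} → IsAntichain B → Ψ (suc i) (τ i B) ≗ Ψ i B
  Ψ-suc-τ {i} {B} B-anti x = begin
    Ψ (suc i) (τ i B) x        ≡⟨ sym (τᴶ-Ψ (τ-isAntichain B-anti) x) ⟩
    τᴶ i (Ψ i (τ i B)) x       ≡⟨ τᴶ-cong i (Ψ-τ B-anti) x ⟩
    τᴶ i (Ψ (suc i) B) x       ≡⟨ τᴶ-cong i (sym ∘ τᴶ-Ψ B-anti) x ⟩
    τᴶ i (τᴶ i (Ψ i B)) x      ≡⟨ τᴶ-involutive i (Ψ i B) x ⟩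
    Ψ i B x                    ∎
    where open ≡-Reasoning

  Ψ-via-τᴶ : ∀ {i B} → IsAntichain B → Ψ i B ≗ τᴶ i (Ψ (suc i) B)
  Ψ-via-τᴶ {i} {B} B-anti x =
    sym (trans (τᴶ-cong i (sym ∘ τᴶ-Ψ B-anti) x) (τᴶ-involutive i (Ψ i B) x))

  -- Words of toggles and rowvacuation

  segᴶ : ℕ → ℕ → Subset → Subset
  segᴶ k zero    X = X
  segᴶ k (suc m) X = τᴶ k (segᴶ (suc k) m X)

  segᴶ⁻¹ : ℕ → ℕ → Subset → Subset
  segᴶ⁻¹ k zero    X = X
  segᴶ⁻¹ k (suc m) X = segᴶ⁻¹ (suc k) m (τᴶ k X)

  rvacᴶ : ℕ → ℕ → Subset → Subset
  rvacᴶ k zero    X = X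
  rvacᴶ k (suc m) X = rvacᴶ (suc k) m (segᴶ k (suc m) X)

  segᴶ-cong : ∀ k m {X Y} → X ≗ Y → segᴶ k m X ≗ segᴶ k m Y
  segᴶ-cong k zero    X≗Y = X≗Y
  segᴶ-cong k (suc m) X≗Y = τᴶ-cong k (segᴶ-cong (suc k) m X≗Y)

  segᴶ⁻¹-cong : ∀ k m {X Y} → X ≗ Y → segᴶ⁻¹ k m X ≗ segᴶ⁻¹ k m Y
  segᴶ⁻¹-cong k zero    X≗Y = X≗Y
  segᴶ⁻¹-cong k (suc m) X≗Y = segᴶ⁻¹-cong (suc k) m (τᴶ-cong k X≗Y)

  rvacᴶ-cong : ∀ k m {X Y} → X ≗ Y → rvacᴶ k m X ≗ rvacᴶ k m Y
  rvacᴶ-cong k zero    X≗Y = X≗Y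
  rvacᴶ-cong k (suc m) X≗Y = rvacᴶ-cong (suc k) m (segᴶ-cong k (suc m) X≗Y)

  segᴶ⁻¹-segᴶ : ∀ k m X → segᴶ⁻¹ k m (segᴶ k m X) ≗ X
  segᴶ⁻¹-segᴶ k zero    X x = refl
  segᴶ⁻¹-segᴶ k (suc m) X x =
    trans (segᴶ⁻¹-cong (suc k) m (τᴶ-involutive k (segᴶ (suc k) m X)) x) (segᴶ⁻¹-segᴶ (suc k) m X x)

  segᴶ-segᴶ⁻¹ : ∀ k m X → segᴶ k m (segᴶ⁻¹ k m X) ≗ X
  segᴶ-segᴶ⁻¹ k zero    X x = refl
  segᴶ-segᴶ⁻¹ k (suc m) X x =
    trans (τᴶ-cong k (segᴶ-segᴶ⁻¹ (suc k) m (τᴶ k X)) x) (τᴶ-involutive k X x)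

  τᴶ-segᴶ : ∀ {i} j m → suc i < j → ∀ X → τᴶ i (segᴶ j m X) ≗ segᴶ j m (τᴶ i X)
  τᴶ-segᴶ j zero    i+1<j X x = refl
  τᴶ-segᴶ j (suc m) i+1<j X x =
    trans (τᴶ-comm i+1<j (segᴶ (suc j) m X) x) (τᴶ-cong j (τᴶ-segᴶ (suc j) m (ℕ.m<n⇒m<1+n i+1<j) X) x)

  τᴶ-rvacᴶ : ∀ {i} j m → suc i < j → ∀ X → τᴶ i (rvacᴶ j m X) ≗ rvacᴶ j m (τᴶ i X)
  τᴶ-rvacᴶ j zero    i+1<j X x = refl
  τᴶ-rvacᴶ j (suc m) i+1<j X x =
    trans (τᴶ-rvacᴶ (suc j) m (ℕ.m<n⇒m<1+n i+1<j) (segᴶ j (suc m) X) x)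
          (rvacᴶ-cong (suc j) m (τᴶ-segᴶ j (suc m) i+1<j X) x)

  segᴶ-rvacᴶ : ∀ k m X → segᴶ k (suc m) (rvacᴶ (suc k) m X) ≗ rvacᴶ (suc k) m (segᴶ⁻¹ k (suc m) X)
  segᴶ-rvacᴶ k zero    X x = refl
  segᴶ-rvacᴶ k (suc m) X x = begin
    τᴶ k (segᴶ (suc k) (suc m) (rvacᴶ (suc (suc k)) m (segᴶ (suc k) (suc m) X))) x
      ≡⟨ τᴶ-cong k (segᴶ-rvacᴶ (suc k) m (segᴶ (suc k) (suc m) X)) x ⟩
    τᴶ k (rvacᴶ (suc (suc k)) m (segᴶ⁻¹ (suc k) (suc m) (segᴶ (suc k) (suc m) X))) x
      ≡⟨ τᴶ-cong k (rvacᴶ-cong (suc (suc k)) m (segᴶ⁻¹-segᴶ (suc k) (suc m) X)) x ⟩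
    τᴶ k (rvacᴶ (suc (suc k)) m X) x
      ≡⟨ τᴶ-rvacᴶ (suc (suc k)) m ℕ.≤-refl X x ⟩
    rvacᴶ (suc (suc k)) m (τᴶ k X) x
      ≡⟨ rvacᴶ-cong (suc (suc k)) m (λ y → sym (segᴶ-segᴶ⁻¹ (suc k) (suc m) (τᴶ k X) y)) x ⟩
    rvacᴶ (suc (suc k)) m (segᴶ (suc k) (suc m) (segᴶ⁻¹ (suc k) (suc m) (τᴶ k X))) x ∎
    where open ≡-Reasoning

  segᴶ-rvacᴶ-same : ∀ k n X → segᴶ k n (rvacᴶ k n X) ≗ rvacᴶ (suc k) (n ∸ 1) X
  segᴶ-rvacᴶ-same k zero    X x = refl
  segᴶ-rvacᴶ-same k (suc m) X x =
    trans (segᴶ-rvacᴶ k m (segᴶ k (suc m) X) x) (rvacᴶ-cong (suc k) m (segᴶ⁻¹-segᴶ k (suc m) X) x)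

  interval : ℕ → ℕ → List ℕ
  interval k m = map (k +_) (upTo m)

  interval-suc : ∀ k m → interval k (suc m) ≡ k ∷ interval (suc k) m
  interval-suc k m = cong₂ _∷_ (ℕ.+-identityʳ k) (begin
    map (k +_) (applyUpTo suc m)     ≡⟨ map-applyUpTo suc (k +_) m ⟩
    applyUpTo ((k +_) ∘ suc) m       ≡⟨ sym (map-applyUpTo id ((k +_) ∘ suc) m) ⟩
    map ((k +_) ∘ suc) (upTo m)      ≡⟨ map-cong (ℕ.+-suc k) (upTo m) ⟩
    map (suc k +_) (upTo m)          ∎)
    where open ≡-Reasoning

  seg-interval : ∀ k m → k + m ≡ suc rank → seg k ≡ applyRanks (interval k m)
  seg-interval k m k+m≡ = cong (applyRanks ∘ interval k) (trans (cong (_∸ k) (sym k+m≡)) (ℕ.m+n∸m≡n k m))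

  applyRanks-isAntichain : ∀ is {B} → IsAntichain B → IsAntichain (applyRanks is B)
  applyRanks-isAntichain []       B-anti = B-anti
  applyRanks-isAntichain (i ∷ is) B-anti = applyRanks-isAntichain is (τ-isAntichain B-anti)

  rvac-isAntichain : ∀ {B} → IsAntichain B → IsAntichain (rvac B)
  rvac-isAntichain = segs-isAntichain (upTo (suc rank))
    where
    segs-isAntichain : ∀ js {B} → IsAntichain B → IsAntichain (foldl (flip seg) B js)
    segs-isAntichain []       B-anti = B-anti
    segs-isAntichain (j ∷ js) B-anti = segs-isAntichain js (applyRanks-isAntichain (ranksFrom j) B-anti)

  rowInv-isAntichain : ∀ {B} → IsAntichain B → IsAntichain (rowInv B)
  rowInv-isAntichain = applyRanks-isAntichain (reverse (ranksFrom 0))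

  applyRanks-reverse : ∀ is B → applyRanks (reverse is) B ≡ foldr τ B is
  applyRanks-reverse is B = trans (applyRanks-foldl (reverse is) B) (foldl-ʳ++ (flip τ) B is)
    where
    applyRanks-foldl : ∀ is B → applyRanks is B ≡ foldl (flip τ) B is
    applyRanks-foldl []       B = refl
    applyRanks-foldl (i ∷ is) B = applyRanks-foldl is (τ i B)

  Ψ-applyRanks : ∀ k m {n} → k + m ≡ n → ∀ {B} → IsAntichain B → Ψ n (applyRanks (interval k m) B) ≗ Ψ k B
  Ψ-applyRanks k zero    k+0≡n {B} _ x = cong (λ n → Ψ n B x) (trans (sym k+0≡n) (ℕ.+-identityʳ k))
  Ψ-applyRanks k (suc m) {n} k+m≡n {B} B-anti x =
    trans (cong (λ is → Ψ n (applyRanks is B) x) (interval-suc k m)) $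
    trans (Ψ-applyRanks (suc k) m (trans (sym (ℕ.+-suc k m)) k+m≡n) (τ-isAntichain B-anti) x) (Ψ-suc-τ B-anti x)

  Ψ-foldr : ∀ k m {n} → k + m ≡ n → ∀ {B} → IsAntichain B → Ψ k (foldr τ B (interval k m)) ≗ Ψ n B
  Ψ-foldr k zero    k+0≡n {B} _ x = cong (λ n → Ψ n B x) (trans (sym (ℕ.+-identityʳ k)) k+0≡n)
  Ψ-foldr k (suc m) k+m≡n {B} B-anti x =
    trans (cong (λ is → Ψ k (foldr τ B is) x) (interval-suc k m)) $
    trans (Ψ-τ (foldr-isAntichain (interval (suc k) m)) x) (Ψ-foldr (suc k) m (trans (sym (ℕ.+-suc k m)) k+m≡n) B-anti x)
    where
    foldr-isAntichain : ∀ is → IsAntichain (foldr τ B is)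
    foldr-isAntichain []       = B-anti
    foldr-isAntichain (i ∷ is) = τ-isAntichain (foldr-isAntichain is)

  Ψ-segᴶ : ∀ k m {n} → k + m ≡ n → ∀ {B} → IsAntichain B → Ψ k B ≗ segᴶ k m (Ψ n B)
  Ψ-segᴶ k zero    k+0≡n {B} _ x = cong (λ n → Ψ n B x) (trans (sym (ℕ.+-identityʳ k)) k+0≡n)
  Ψ-segᴶ k (suc m) k+m≡n B-anti x =
    trans (Ψ-via-τᴶ B-anti x) (τᴶ-cong k (Ψ-segᴶ (suc k) m (trans (sym (ℕ.+-suc k m)) k+m≡n) B-anti) x)

  Ψ⊤ : Subset → Subset
  Ψ⊤ = Ψ (suc rank)

  Ψ⊤-seg : ∀ k m → k + m ≡ suc rank → ∀ {B} → IsAntichain B → Ψ⊤ (seg k B) ≗ segᴶ k m (Ψ⊤ B)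
  Ψ⊤-seg k m k+m≡ {B} B-anti x = begin
    Ψ⊤ (seg k B) x                          ≡⟨ cong (λ f → Ψ⊤ (f B) x) (seg-interval k m k+m≡) ⟩
    Ψ⊤ (applyRanks (interval k m) B) x      ≡⟨ Ψ-applyRanks k m k+m≡ B-anti x ⟩
    Ψ k B x                                 ≡⟨ Ψ-segᴶ k m k+m≡ B-anti x ⟩
    segᴶ k m (Ψ⊤ B) x                       ∎
    where open ≡-Reasoning

  Ψ⊤-rvac-from : ∀ k m → k + m ≡ suc rank → ∀ {B} → IsAntichain B →
                 Ψ⊤ (foldl (flip seg) B (interval k m)) ≗ rvacᴶ k m (Ψ⊤ B)
  Ψ⊤-rvac-from k zero    _     _      x = refl
  Ψ⊤-rvac-from k (suc m) k+m≡ {B} B-anti x =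
    trans (cong (λ js → Ψ⊤ (foldl (flip seg) B js) x) (interval-suc k m)) $
    trans (Ψ⊤-rvac-from (suc k) m (trans (sym (ℕ.+-suc k m)) k+m≡) (applyRanks-isAntichain (ranksFrom k) B-anti) x)
          (rvacᴶ-cong (suc k) m (Ψ⊤-seg k (suc m) k+m≡ B-anti) x)

  Ψ⊤-rvac : ∀ {B} → IsAntichain B → Ψ⊤ (rvac B) ≗ rvacᴶ 0 (suc rank) (Ψ⊤ B)
  Ψ⊤-rvac {B} B-anti x = begin
    Ψ⊤ (rvac B) x
      ≡⟨ cong (λ js → Ψ⊤ (foldl (flip seg) B js) x) (sym (map-id (upTo (suc rank)))) ⟩
    Ψ⊤ (foldl (flip seg) B (interval 0 (suc rank))) x      ≡⟨ Ψ⊤-rvac-from 0 (suc rank) refl B-anti x ⟩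
    rvacᴶ 0 (suc rank) (Ψ⊤ B) x                            ∎
    where open ≡-Reasoning

  Ψ0-rowInv : ∀ {B} → IsAntichain B → Ψ 0 (rowInv B) ≗ Ψ⊤ B
  Ψ0-rowInv {B} B-anti x =
    trans (cong (λ C → Ψ 0 C x) (applyRanks-reverse (interval 0 (suc rank)) B)) (Ψ-foldr 0 (suc rank) refl B-anti x)

  Ψ0-rvac : ∀ {B} → IsAntichain B → Ψ 0 (rvac B) ≗ segᴶ 0 (suc rank) (rvacᴶ 1 rank (Ψ 0 B))
  Ψ0-rvac {B} B-anti x = begin
    Ψ 0 (rvac B) x                                              ≡⟨ Ψ-segᴶ 0 (suc rank) refl (rvac-isAntichain B-anti) x ⟩
    segᴶ 0 (suc rank) (Ψ⊤ (rvac B)) x                           ≡⟨ segᴶ-cong 0 (suc rank) (Ψ⊤-rvac B-anti) x ⟩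
    segᴶ 0 (suc rank) (rvacᴶ 1 rank (segᴶ 0 (suc rank) (Ψ⊤ B))) x
      ≡⟨ segᴶ-cong 0 (suc rank) (rvacᴶ-cong 1 rank (sym ∘ Ψ-segᴶ 0 (suc rank) refl B-anti)) x ⟩
    segᴶ 0 (suc rank) (rvacᴶ 1 rank (Ψ 0 B)) x                  ∎
    where open ≡-Reasoning

  Ψ0-rvac-positive : ∀ {B x} → IsAntichain B → 1 ≤ rk x → Ψ 0 (rvac B) x ≡ rvacᴶ 2 (rank ∸ 1) (Ψ 0 B) x
  Ψ0-rvac-positive {B} {x} B-anti 1≤rx =
    trans (Ψ0-rvac B-anti x) $
    trans (τᴶ-elsewhere (segᴶ 1 rank (rvacᴶ 1 rank (Ψ 0 B))) (ℕ.<⇒≢ 1≤rx ∘ sym))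
          (segᴶ-rvacᴶ-same 1 rank (Ψ 0 B) x)

  Ψ0≡downset : ∀ B x → Ψ 0 B x ≡ downset B x
  Ψ0≡downset B x = Ψ-above B ℕ.z≤n

  Maximal : Subset → Carrier → Set
  Maximal D x = x ∈ₛ D × ∀ y → x ≺ y → ¬ y ∈ₛ D

  ∈⇔maximal-in-downset : ∀ {B x} → IsAntichain B → x ∈ₛ B ⇔ Maximal (downset B) x
  ∈⇔maximal-in-downset {B} {x} B-anti = mk⇔ ⇒ ⇐
    where
    ⇒ : x ∈ₛ B → Maximal (downset B) x
    ⇒ x∈B = from (does⇔ (x ∈↓? B)) (x , x∈B , ≼-refl) ,
            λ y x≺y y∈↓ → proj₂ (∈-isolated B-anti x∈B) y x≺y (to (does⇔ (y ∈↓? B)) y∈↓)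
    ⇐ : Maximal (downset B) x → x ∈ₛ B
    ⇐ (x∈↓ , maximal) with to (does⇔ (x ∈↓? B)) x∈↓
    ... | b , b∈B , x≼b with x ≟ₚ b
    ...   | yes refl = b∈B
    ...   | no x≢b   = contradiction (from (does⇔ (b ∈↓? B)) (b , b∈B , ≼-refl)) (maximal b (x≼b , x≢b))

  applyRanks-elsewhere : ∀ is {B x} → All (rk x ≢_) is → applyRanks is B x ≡ B x
  applyRanks-elsewhere []       []               = refl
  applyRanks-elsewhere (i ∷ is) (rx≢i ∷ rx≢is) = trans (applyRanks-elsewhere is rx≢is) (τ-elsewhere rx≢i)

  rvac-at-rank-0 : ∀ {B x} → rk x ≡ 0 → rvac B x ≡ τ 0 B x
  rvac-at-rank-0 {B} {x} rx =
    trans (later-segs (applyUpTo suc rank) (applyUpTo⁺₂ suc rank λ _ → ℕ.s≤s ℕ.z≤n))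
          (applyRanks-elsewhere (map (0 +_) (applyUpTo suc rank)) (map⁺ (applyUpTo⁺₂ suc rank λ _ → positive (ℕ.s≤s ℕ.z≤n))))
    where
    positive : ∀ {n} → 1 ≤ n → rk x ≢ n
    positive 1≤n rx≡n = ℕ.<⇒≢ 1≤n (trans (sym rx) rx≡n)
    later-segs : ∀ js {C} → All (1 ≤_) js → foldl (flip seg) C js x ≡ C x
    later-segs []       []           = refl
    later-segs (j ∷ js) (1≤j ∷ 1≤js) =
      trans (later-segs js 1≤js)
            (applyRanks-elsewhere (ranksFrom j) (map⁺ (All.universal (λ n → positive (ℕ.≤-trans 1≤j (ℕ.m≤m+n j n))) _)))

  τ-at-rank-0 : ∀ {B x} → IsAntichain B → rk x ≡ 0 → x ∈ₛ τ 0 B ⇔ (¬ x ∈↓ B)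
  τ-at-rank-0 {B} {x} B-anti rx = mk⇔
    (λ x∈τB → proj₂ (to (does⇔ (free? B x)) (trans (sym (τ-at-rank B-anti rx)) x∈τB)))
    (λ x∉↓ → trans (τ-at-rank B-anti rx) (dec-true (free? B x) ((λ (b , b∈B , b≼x) → x∉↓ (b , b∈B , x≼b b≼x)) , x∉↓)))
    where
    x≼b : ∀ {b} → b ≼ x → x ≼ b
    x≼b {b} b≼x with ≼-same-rank b≼x (trans (ℕ.n≤0⇒n≡0 (subst (rk b ≤_) rx (rk-mono b≼x))) (sym rx))
    ... | refl = ≼-refl

-- The subposet P≥1

module _ (P : RankedFinPoset) (graded : IsGradedFinPoset P) where
  open RankedFinPoset P renaming (_≟_ to _≟ₚ_)
  open IsGradedFinPoset graded
  open IsPartialOrder isPartialOrder using () renaming (refl to ≼-refl; trans to ≼-trans; antisym to ≼-antisym)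
  open GradedFinPoset P graded using (_≺?_; ∃?; step-below; rk-mono)

  -- The selector enumerating P≥1 is private to Defs; unification recovers it.
  private
    selector : Σ (Carrier → Maybe (GeOne P)) λ f → RankedFinPoset.elems (P≥1 P) ≡ mapMaybe f elems
    selector = _ , refl

    select : Carrier → Maybe (GeOne P)
    select = proj₁ selector

    select-just : ∀ x (h : 1 ≤ rk x) → select x ≡ just (x , h)
    select-just x h with 1 ℕ.≤? rk x
    ... | yes h′ = cong (λ h → just (x , h)) (ℕ.≤-irrelevant h′ h)
    ... | no ¬h  = contradiction h ¬h

    select-proj₁ : ∀ {x a} → select x ≡ just a → proj₁ a ≡ x
    select-proj₁ {x} e with 1 ℕ.≤? rk x
    select-proj₁ refl | yes _ = refl

  P≥1-isGraded : IsGradedFinPoset (P≥1 P)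
  P≥1-isGraded = record
    { elems-complete = λ (x , h) → ∈-mapMaybe⁺ select (elems-complete x) (select-just x h)
    ; elems-unique   = mapMaybe-unique select proj₁ select-proj₁ elems-unique
    ; isPartialOrder = record
      { isPreorder = record
        { isEquivalence = ≡.isEquivalence
        ; reflexive     = λ { refl → ≼-refl }
        ; trans         = ≼-trans
        }
      ; antisym = λ a≼b b≼a → GeOne-≡ P (≼-antisym a≼b b≼a)
      }
    ; rk-minimal = rk-minimal≥1
    ; rk-maximal = λ (x , h) maximal →
        cong (_∸ 1) (rk-maximal x λ y x≼y → cong proj₁ (maximal (y , ℕ.≤-trans h (rk-mono x≼y)) x≼y))
    ; rk-cover = rk-cover≥1
    }
    where
    rk-minimal≥1 : ∀ (a : GeOne P) → (∀ b → proj₁ b ≼ proj₁ a → b ≡ a) → rk (proj₁ a) ∸ 1 ≡ 0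
    rk-minimal≥1 (x , h) minimal with ∃? (_≺? x)
    ... | no ∄y≺x = cong (_∸ 1) (rk-minimal x λ y y≼x → decide-≡ y y≼x)
      where
      decide-≡ : ∀ y → y ≼ x → y ≡ x
      decide-≡ y y≼x with y ≟ₚ x
      ... | yes y≡x = y≡x
      ... | no y≢x  = contradiction (y , y≼x , y≢x) ∄y≺x
    ... | yes (y , y≺x) with step-below y≺x
    ...   | z , _ , (z≼x , z≢x) , rz with 1 ℕ.≤? rk z
    ...     | yes 1≤rz = contradiction (cong proj₁ (minimal (z , 1≤rz) z≼x)) z≢x
    ...     | no 1≰rz  = trans (cong (_∸ 1) (sym rz)) (ℕ.n<1⇒n≡0 (ℕ.≰⇒> 1≰rz))
    rk-cover≥1 : ∀ (a b : GeOne P) → RankedFinPoset._⋖_ (P≥1 P) a b → rk (proj₁ b) ∸ 1 ≡ suc (rk (proj₁ a) ∸ 1)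
    rk-cover≥1 (x , h) (y , _) (x≼y , a≢b , between) =
      trans (cong (_∸ 1) (rk-cover x y (x≼y , (a≢b ∘ GeOne-≡ P) , between′))) (sym (ℕ.m+[n∸m]≡n h))
      where
      between′ : ∀ z → x ≼ z → z ≼ y → z ≡ x ⊎ z ≡ y
      between′ z x≼z z≼y = Sum.map (cong proj₁) (cong proj₁) (between (z , ℕ.≤-trans h (rk-mono x≼z)) x≼z z≼y)

module Restriction (P : RankedFinPoset) (graded : IsGradedFinPoset P) where
  open RankedFinPoset P
  open Ops P using (Subset; _∈ₛ_; IsAntichain; rvac)
  module G  = GradedFinPoset P graded
  module G₁ = GradedFinPoset (P≥1 P) (P≥1-isGraded P graded)
  open G using (rk-mono; _≺_)

  toggleable-restrict : ∀ {X x} (h : 1 ≤ rk x) → 2 ≤ rk x →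
                        G₁.Toggleable (restrict P X) (x , h) ⇔ G.Toggleable X x
  toggleable-restrict {X} {x} h 2≤rx = mk⇔
    (λ (lower₁ , upper₁) →
      (λ y y≼x ry → let hy = lower-rank ry in lower₁ (y , hy) y≼x (trans (ℕ.m+[n∸m]≡n hy) (cong (_∸ 1) ry))) ,
      (λ y x≼y ry → upper₁ (y , upper-rank x≼y) x≼y (trans (cong (_∸ 1) ry) (sym (ℕ.m+[n∸m]≡n h)))))
    (λ (lower , upper) →
      (λ (y , hy) y≼x ry₁ → lower y y≼x (trans (cong suc (sym (ℕ.m+[n∸m]≡n hy))) (trans (cong suc ry₁) (ℕ.m+[n∸m]≡n h)))) ,
      (λ (y , hy) x≼y ry₁ → upper y x≼y (trans (sym (ℕ.m+[n∸m]≡n hy)) (trans (cong suc ry₁) (cong suc (ℕ.m+[n∸m]≡n h))))))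
    where
    lower-rank : ∀ {y} → suc (rk y) ≡ rk x → 1 ≤ rk y
    lower-rank ry = ℕ.≤-pred (subst (2 ≤_) (sym ry) 2≤rx)
    upper-rank : ∀ {y} → x ≼ y → 1 ≤ rk y
    upper-rank x≼y = ℕ.≤-trans h (rk-mono x≼y)

  -- k ≥ 1 is needed: in P≥1 the elements of rank 0 have lost their lower covers.
  τᴶ-restrict : ∀ {k} → 1 ≤ k → ∀ X → G₁.τᴶ k (restrict P X) ≗ restrict P (G.τᴶ (suc k) X)
  τᴶ-restrict {k} 1≤k X (x , h) with rk x ℕ.≟ suc k
  ... | yes rx =
    trans (G₁.τᴶ-at (restrict P X) {x , h} (cong (_∸ 1) rx)) $
    trans (cong (X x xor_) (does-cong (toggleable-restrict h 2≤rx)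
                                      (G₁.toggleable? (restrict P X) (x , h)) (G.toggleable? X x)))
          (sym (G.τᴶ-at X rx))
    where
    2≤rx : 2 ≤ rk x
    2≤rx = subst (2 ≤_) (sym rx) (ℕ.s≤s 1≤k)
  ... | no rx =
    trans (G₁.τᴶ-elsewhere (restrict P X) {x , h} (λ e → rx (trans (sym (ℕ.m+[n∸m]≡n h)) (cong suc e))))
          (sym (G.τᴶ-elsewhere X rx))

  segᴶ-restrict : ∀ k m → 1 ≤ k → ∀ X → G₁.segᴶ k m (restrict P X) ≗ restrict P (G.segᴶ (suc k) m X)
  segᴶ-restrict k zero    _   X a = refl
  segᴶ-restrict k (suc m) 1≤k X a =
    trans (G₁.τᴶ-cong k (segᴶ-restrict (suc k) m (ℕ.m≤n⇒m≤1+n 1≤k) X) a)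
          (τᴶ-restrict 1≤k (G.segᴶ (suc (suc k)) m X) a)

  rvacᴶ-restrict : ∀ k m → 1 ≤ k → ∀ X → G₁.rvacᴶ k m (restrict P X) ≗ restrict P (G.rvacᴶ (suc k) m X)
  rvacᴶ-restrict k zero    _   X a = refl
  rvacᴶ-restrict k (suc m) 1≤k X a =
    trans (G₁.rvacᴶ-cong (suc k) m (segᴶ-restrict k (suc m) 1≤k X) a)
          (rvacᴶ-restrict (suc k) m (ℕ.m≤n⇒m≤1+n 1≤k) (G.segᴶ (suc k) (suc m) X) a)

  Ψ0-restrict : ∀ A → G₁.Ψ 0 (restrict P A) ≗ restrict P (G.Ψ 0 A)
  Ψ0-restrict A (x , h) =
    trans (G₁.Ψ0≡downset (restrict P A) (x , h)) $
    trans (does-cong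
             (mk⇔ (λ ((b , _) , b∈A , x≼b) → b , b∈A , x≼b)
                  (λ (b , b∈A , x≼b) → (b , ℕ.≤-trans h (rk-mono x≼b)) , b∈A , x≼b))
             (G₁._∈↓?_ (x , h) (restrict P A)) (G._∈↓?_ x A))
          (sym (G.Ψ0≡downset A x))

  module _ {A : Subset} (A-anti : IsAntichain A) where
    Ā : Ops.Subset (P≥1 P)
    Ā = restrict P A

    Ā-anti : Ops.IsAntichain (P≥1 P) Ā
    Ā-anti a b a∈Ā b∈Ā a≼b = GeOne-≡ P (A-anti _ _ a∈Ā b∈Ā a≼b)

    rowInv-rvac : Ops.Subset (P≥1 P)
    rowInv-rvac = Ops.rowInv (P≥1 P) (Ops.rvac (P≥1 P) Ā)

    downset-rowInv-rvac : ∀ x (h : 1 ≤ rk x) → G₁.downset rowInv-rvac (x , h) ≡ G.downset (rvac A) x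
    downset-rowInv-rvac x h = begin
      G₁.downset rowInv-rvac (x , h)                         ≡⟨ sym (G₁.Ψ0≡downset rowInv-rvac (x , h)) ⟩
      G₁.Ψ 0 rowInv-rvac (x , h)                             ≡⟨ G₁.Ψ0-rowInv (G₁.rvac-isAntichain Ā-anti) (x , h) ⟩
      G₁.Ψ⊤ (Ops.rvac (P≥1 P) Ā) (x , h)                     ≡⟨ G₁.Ψ⊤-rvac Ā-anti (x , h) ⟩
      G₁.rvacᴶ 1 (rank ∸ 1) (G₁.segᴶ 0 (suc (rank ∸ 1)) (G₁.Ψ⊤ Ā)) (x , h)
        ≡⟨ G₁.rvacᴶ-cong 1 (rank ∸ 1) (sym ∘ G₁.Ψ-segᴶ 0 (suc (rank ∸ 1)) refl Ā-anti) (x , h) ⟩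
      G₁.rvacᴶ 1 (rank ∸ 1) (G₁.Ψ 0 Ā) (x , h)               ≡⟨ G₁.rvacᴶ-cong 1 (rank ∸ 1) (Ψ0-restrict A) (x , h) ⟩
      G₁.rvacᴶ 1 (rank ∸ 1) (restrict P (G.Ψ 0 A)) (x , h)   ≡⟨ rvacᴶ-restrict 1 (rank ∸ 1) ℕ.≤-refl (G.Ψ 0 A) (x , h) ⟩
      G.rvacᴶ 2 (rank ∸ 1) (G.Ψ 0 A) x                       ≡⟨ sym (G.Ψ0-rvac-positive A-anti h) ⟩
      G.Ψ 0 (rvac A) x                                       ≡⟨ G.Ψ0≡downset (rvac A) x ⟩
      G.downset (rvac A) x                                   ∎
      where open ≡-Reasoning

    rvac⇔rowInv-rvac : ∀ {p} (h : 1 ≤ rk p) → p ∈ₛ rvac A ⇔ Ops._∈ₛ_ (P≥1 P) (p , h) rowInv-rvac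
    rvac⇔rowInv-rvac {p} h =
      ⇔.trans (G.∈⇔maximal-in-downset (G.rvac-isAntichain A-anti)) $
      ⇔.trans (mk⇔ ⇒ ⇐) $
      ⇔.sym (G₁.∈⇔maximal-in-downset (G₁.rowInv-isAntichain (G₁.rvac-isAntichain Ā-anti)))
      where
      ⇒ : G.Maximal (G.downset (rvac A)) p → G₁.Maximal (G₁.downset rowInv-rvac) (p , h)
      ⇒ (p∈↓ , maximal) =
        trans (downset-rowInv-rvac p h) p∈↓ ,
        λ (y , hy) (p≼y , p≢y) y∈↓ → maximal y (p≼y , p≢y ∘ GeOne-≡ P) (trans (sym (downset-rowInv-rvac y hy)) y∈↓)
      ⇐ : G₁.Maximal (G₁.downset rowInv-rvac) (p , h) → G.Maximal (G.downset (rvac A)) p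
      ⇐ (p∈↓ , maximal) =
        trans (sym (downset-rowInv-rvac p h)) p∈↓ ,
        λ y (p≼y , p≢y) y∈↓ →
          let hy = ℕ.≤-trans h (rk-mono p≼y)
          in maximal (y , hy) (p≼y , p≢y ∘ cong proj₁) (trans (downset-rowInv-rvac y hy) y∈↓)

lemma2p18 : (P : RankedFinPoset) → IsGradedFinPoset P →
    (A : Ops.Subset P) → Ops.IsAntichain P A →
    ((p : RankedFinPoset.Carrier P) → RankedFinPoset.rk P p ≡ 0 →
       ((Ops._∈ₛ_ P p (Ops.rvac P A)) ⇔ (Ops._∈ₛ_ P p (Ops.τ P 0 A)))
       × ((Ops._∈ₛ_ P p (Ops.rvac P A))
            ⇔ (¬ ∃ (λ q → Ops._∈ₛ_ P q A × RankedFinPoset._≼_ P p q))))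
    × ((p : RankedFinPoset.Carrier P) → (h : 1 ≤ RankedFinPoset.rk P p) →
       (Ops._∈ₛ_ P p (Ops.rvac P A))
         ⇔ (Ops._∈ₛ_ (P≥1 P) (p , h)
              (Ops.rowInv (P≥1 P) (Ops.rvac (P≥1 P) (restrict P A)))))
lemma2p18 P graded A A-anti = rank-0 , λ p → Restriction.rvac⇔rowInv-rvac P graded A-anti
  where
  open RankedFinPoset P
  open Ops P
  open GradedFinPoset P graded using (rvac-at-rank-0; τ-at-rank-0)
  rank-0 : ∀ p → rk p ≡ 0 → (p ∈ₛ rvac A ⇔ p ∈ₛ τ 0 A) × (p ∈ₛ rvac A ⇔ (¬ ∃ λ q → q ∈ₛ A × p ≼ q))
  rank-0 p rp = rvac⇔τ0 , ⇔.trans rvac⇔τ0 (τ-at-rank-0 A-anti rp)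
    where
    rvac⇔τ0 : p ∈ₛ rvac A ⇔ p ∈ₛ τ 0 A
    rvac⇔τ0 = mk⇔ (trans (sym (rvac-at-rank-0 rp))) (trans (rvac-at-rank-0 rp))
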